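{- Let $t$ be a positive integer and let $S$ be a skew-symmetric EW matrix of order $4t+2$. Write $S=\begin{pmatrix}S_{11} & S_{12}\\ S_{21} & S_{22}\end{pmatrix}$ where each $S_{ij}$ is a $(2t+1)\times(2t+1)$ matrix, and let $J$ denote the $(2t+1)\times(2t+1)$ all-ones matrix. Then $S_{11}J=S_{22}J=J$, and there is a sign $\epsilon\in\{1,-1\}$ such that $S_{12}J=-S_{21}J=\epsilon\sqrt{8t+1}\,J$.
   Context: For $n\equiv 2\pmod 4$, a $\{1,-1\}$-matrix $B$ of order $n$ is called an EW matrix if \[ BB^\top=B^\top B=\begin{pmatrix}(n-2)I_{n/2}+2J_{n/2} & O\\ O & (n-2)I_{n/2}+2J_{n/2}\end{pmatrix}, \] where $I$ is the identity matrix, $J$ the all-ones matrix and $O$ the zero matrix. A $\{1,-1\}$-matrix $X$ is called skew-symmetric if $X+X^\top=2I$. -}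

module Defs where

import Data.Nat
open import Data.Nat using (ℕ; zero; suc)
open import Data.Fin using (Fin; zero; suc; splitAt; _↑ˡ_; _↑ʳ_)
open import Data.Integer using (ℤ; +_; -_; _+_; _-_; _*_)
open import Data.Sum using (_⊎_; inj₁; inj₂)
open import Data.Product using (_×_)
open import Relation.Binary.PropositionalEquality using (_≡_)
open import Relation.Nullary using (Dec; yes; no)
open import Data.Fin using (_≟_)

Matrix : ℕ → ℕ → Set
Matrix m n = Fin m → Fin n → ℤ

∑ : ∀ {n} → (Fin n → ℤ) → ℤ
∑ {zero}  f = + 0
∑ {suc n} f = f zero + ∑ (λ i → f (suc i))

_⊗_ : ∀ {m n p} → Matrix m n → Matrix n p → Matrix m p
(A ⊗ B) i j = ∑ (λ k → A i k * B k j)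

_ᵀ : ∀ {m n} → Matrix m n → Matrix n m
(A ᵀ) i j = A j i

_⊕_ : ∀ {m n} → Matrix m n → Matrix m n → Matrix m n
(A ⊕ B) i j = A i j + B i j

_·_ : ∀ {m n} → ℤ → Matrix m n → Matrix m n
(c · A) i j = c * A i j

I : ∀ n → Matrix n n
I n i j with i ≟ j
... | yes _ = + 1
... | no _  = + 0

J : ∀ m n → Matrix m n
J m n i j = + 1

O : ∀ m n → Matrix m n
O m n i j = + 0

block : ∀ {m n} → Matrix m m → Matrix m n → Matrix n m → Matrix n n
      → Matrix (m Data.Nat.+ n) (m Data.Nat.+ n)
block {m} {n} A B C D i j with splitAt m i | splitAt m j
... | inj₁ a | inj₁ b = A a b
... | inj₁ a | inj₂ b = B a b
... | inj₂ a | inj₁ b = C a b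
... | inj₂ a | inj₂ b = D a b

_≐_ : ∀ {m n} → Matrix m n → Matrix m n → Set
A ≐ B = ∀ i j → A i j ≡ B i j

IsPM : ∀ {m n} → Matrix m n → Set
IsPM A = ∀ i j → (A i j ≡ + 1) ⊎ (A i j ≡ - (+ 1))

IsSkew : ∀ {n} → Matrix n n → Set
IsSkew X = (X ⊕ (X ᵀ)) ≐ ((+ 2) · I _)

-- EW matrix of order n = m + m (so n/2 = m); entries ±1 and
-- B Bᵀ = Bᵀ B = diag((n-2)I + 2J, (n-2)I + 2J)
EWGram : ∀ m → Matrix (m Data.Nat.+ m) (m Data.Nat.+ m)
EWGram m = block D (O m m) (O m m) D
  where
  D : Matrix m m
  D = (((+ (m Data.Nat.+ m)) - (+ 2)) · I m) ⊕ ((+ 2) · J m m)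

IsEW : ∀ m → Matrix (m Data.Nat.+ m) (m Data.Nat.+ m) → Set
IsEW m B = IsPM B × ((B ⊗ (B ᵀ)) ≐ EWGram m) × (((B ᵀ) ⊗ B) ≐ EWGram m)

S₁₁ S₁₂ S₂₁ S₂₂ : ∀ {m} → Matrix (m Data.Nat.+ m) (m Data.Nat.+ m) → Matrix m m
S₁₁ {m} S i j = S (i ↑ˡ m) (j ↑ˡ m)
S₁₂ {m} S i j = S (i ↑ˡ m) (m ↑ʳ j)
S₂₁ {m} S i j = S (m ↑ʳ i) (j ↑ˡ m)
S₂₂ {m} S i j = S (m ↑ʳ i) (m ↑ʳ j)

module Submission where

-- Let S be of order m + m with S Sᵀ = Sᵀ S = G, where G = EWGram m = diag(D, D),
-- D = (2m-2) I + 2 J, and let θ = (2m-2) + 2m be the eigenvalue of D on constant vectors.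
--  (1) A vector that is constant on each half is a θ-eigenvector of G; conversely every
--      θ-eigenvector w of G is flat on each half: m · w_a is the sum of w over its half.
--  (2) S maps θ-eigenvectors of G to θ-eigenvectors, because G S = S Sᵀ S = S G.
--      The images S u₁, S u₂ of u₁ = (1,0) and u₂ = (0,1) are the row-sum vectors of
--      (S₁₁; S₂₁) and (S₁₂; S₂₂), so every block has constant row sums.
--  (3) S + Sᵀ = 2I gives total sum m for S₁₁ and S₂₂, hence row sums 1 there, and
--      S₁₂ = -S₂₁ᵀ, hence opposite row sums β and -β for S₁₂ and S₂₁.
--  (4) Evaluating ⟨S u₁, S u₁⟩ = ⟨u₁, Sᵀ S u₁⟩ gives m (1 + β²) = θ m, so β² = θ - 1,
--      which is 8t + 1 for m = 2t + 1; finally β = ε |β| with ε = ±1.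
-- The file develops finite sums, matrices acting on vectors, the matrices c I + d J,
-- skew-symmetric blocks, and then the row sums for every half-order m; Lemma 4.1 is the
-- instance m = 2t + 1.

module RowSumsOfSkewEW where

  open import Defs
  open import Data.Nat as ℕ using (ℕ; zero; suc)
  open import Data.Fin using (Fin; zero; suc; splitAt; _↑ˡ_; _↑ʳ_; _≟_)
  open import Data.Fin.Properties
    using (splitAt-↑ˡ; splitAt-↑ʳ; splitAt⁻¹-↑ˡ; splitAt⁻¹-↑ʳ; suc-injective; ↑ˡ-injective; ↑ʳ-injective; nonZeroIndex)
  open import Data.Integer using (ℤ; +_; -_; _+_; _-_; _*_; -1ℤ; ∣_∣; +[1+_]; -[1+_]; NonZero)
  open import Data.Integer.Properties hiding (_≟_)
  open import Data.Integer.Tactic.RingSolver using (solve-∀)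
  open import Algebra.Bundles using (AbelianGroup)
  open import Algebra.Properties.Group (AbelianGroup.group +-0-abelianGroup) using (∙-cancelˡ; inverseˡ-unique)
  open import Algebra.Properties.Semiring.Sum +-*-semiring using (sum; ∑-distrib-+; ∑-comm; *-distribˡ-sum)
  open import Data.Vec.Functional using (Vector; _++_; replicate)
  open import Data.Vec.Functional.Properties using (lookup-++ˡ; lookup-++ʳ)
  open import Data.Sum using (_⊎_; inj₁; inj₂)
  open import Data.Product using (_×_; _,_; Σ; proj₁; proj₂)
  open import Relation.Binary.PropositionalEquality hiding (J)
  open import Relation.Nullary using (yes; no; ¬_; contradiction)
  open ≡-Reasoning

  -- Defs.∑ is the library's finite sum in the additive monoid of ℤ, so its
  -- linearity and Fubini laws can be taken from Algebra.Properties.Semiring.Sum.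
  ∑≡sum : ∀ {n} (f : Fin n → ℤ) → ∑ f ≡ sum f
  ∑≡sum {zero}  f = refl
  ∑≡sum {suc n} f = cong (_+_ (f zero)) (∑≡sum (λ i → f (suc i)))

  ∑-cong : ∀ {n} {f g : Fin n → ℤ} → (∀ i → f i ≡ g i) → ∑ f ≡ ∑ g
  ∑-cong {zero}  f≗g = refl
  ∑-cong {suc n} f≗g = cong₂ _+_ (f≗g zero) (∑-cong (λ i → f≗g (suc i)))

  ∑-+ : ∀ {n} (f g : Fin n → ℤ) → ∑ (λ i → f i + g i) ≡ ∑ f + ∑ g
  ∑-+ f g = begin
    ∑ (λ i → f i + g i)   ≡⟨ ∑≡sum (λ i → f i + g i) ⟩
    sum (λ i → f i + g i) ≡⟨ ∑-distrib-+ f g ⟩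
    sum f + sum g         ≡⟨ cong₂ _+_ (∑≡sum f) (∑≡sum g) ⟨
    ∑ f + ∑ g             ∎

  ∑-*ˡ : ∀ {n} (c : ℤ) (f : Fin n → ℤ) → ∑ (λ i → c * f i) ≡ c * ∑ f
  ∑-*ˡ c f = begin
    ∑ (λ i → c * f i)   ≡⟨ ∑≡sum (λ i → c * f i) ⟩
    sum (λ i → c * f i) ≡⟨ *-distribˡ-sum c f ⟨
    c * sum f           ≡⟨ cong (c *_) (∑≡sum f) ⟨
    c * ∑ f             ∎

  ∑-*ʳ : ∀ {n} (c : ℤ) (f : Fin n → ℤ) → ∑ (λ i → f i * c) ≡ ∑ f * c
  ∑-*ʳ c f = begin
    ∑ (λ i → f i * c) ≡⟨ ∑-cong (λ i → *-comm (f i) c) ⟩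
    ∑ (λ i → c * f i) ≡⟨ ∑-*ˡ c f ⟩
    c * ∑ f           ≡⟨ *-comm c (∑ f) ⟩
    ∑ f * c           ∎

  ∑-swap : ∀ {m n} (f : Fin m → Fin n → ℤ) →
           ∑ (λ i → ∑ (f i)) ≡ ∑ (λ j → ∑ (λ i → f i j))
  ∑-swap f = begin
    ∑ (λ i → ∑ (f i))             ≡⟨ ∑²≡sum² f ⟩
    sum (λ i → sum (f i))         ≡⟨ ∑-comm f ⟩
    sum (λ j → sum (λ i → f i j)) ≡⟨ ∑²≡sum² (λ j i → f i j) ⟨
    ∑ (λ j → ∑ (λ i → f i j))     ∎
    where
    ∑²≡sum² : ∀ {m n} (g : Fin m → Fin n → ℤ) → ∑ (λ i → ∑ (g i)) ≡ sum (λ i → sum (g i))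
    ∑²≡sum² g = trans (∑-cong (λ i → ∑≡sum (g i))) (∑≡sum (λ i → sum (g i)))

  ∑-const : ∀ {n} (c : ℤ) → ∑ {n} (λ _ → c) ≡ + n * c
  ∑-const {zero}  c = refl
  ∑-const {suc n} c = trans (cong (_+_ c) (∑-const {n} c)) (sym (suc-* (+ n) c))

  ∑-zero : ∀ {n} → ∑ {n} (λ _ → + 0) ≡ + 0
  ∑-zero {n} = trans (∑-const {n} (+ 0)) (*-zeroʳ (+ n))

  ∑-split : ∀ m n (f : Fin (m ℕ.+ n) → ℤ) →
            ∑ f ≡ ∑ (λ a → f (a ↑ˡ n)) + ∑ (λ b → f (m ↑ʳ b))
  ∑-split zero    n f = sym (+-identityˡ (∑ f))
  ∑-split (suc m) n f =
    trans (cong (_+_ (f zero)) (∑-split m n (λ i → f (suc i)))) (sym (+-assoc (f zero) _ _))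

  I-diag : ∀ n (i : Fin n) → I n i i ≡ + 1
  I-diag n i with i ≟ i
  ... | yes _   = refl
  ... | no i≢i = contradiction refl i≢i

  I-off : ∀ n {i j : Fin n} → ¬ i ≡ j → I n i j ≡ + 0
  I-off n {i} {j} i≢j with i ≟ j
  ... | yes i≡j = contradiction i≡j i≢j
  ... | no _    = refl

  I-reindex : ∀ {m n} (g : Fin m → Fin n) → (∀ {a b} → g a ≡ g b → a ≡ b) →
              ∀ a b → I n (g a) (g b) ≡ I m a b
  I-reindex {n = n} g g-injective a b with a ≟ b
  ... | yes refl = I-diag n (g a)
  ... | no a≢b   = I-off n (λ ga≡gb → a≢b (g-injective ga≡gb))

  ∑-I : ∀ n (i : Fin n) (v : Fin n → ℤ) → ∑ (λ j → I n i j * v j) ≡ v i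
  ∑-I (suc n) zero v = begin
    I (suc n) zero zero * v zero + ∑ (λ j → I (suc n) zero (suc j) * v (suc j))
      ≡⟨ cong₂ _+_ (cong (_* v zero) (I-diag (suc n) zero))
                   (∑-cong (λ j → cong (_* v (suc j)) (I-off (suc n) {zero} {suc j} λ ()))) ⟩
    + 1 * v zero + ∑ (λ j → + 0 * v (suc j))
      ≡⟨ cong₂ _+_ (*-identityˡ (v zero)) (trans (∑-cong (λ j → *-zeroˡ (v (suc j)))) (∑-zero {n})) ⟩
    v zero + + 0
      ≡⟨ +-identityʳ (v zero) ⟩
    v zero ∎
  ∑-I (suc n) (suc i) v = begin
    I (suc n) (suc i) zero * v zero + ∑ (λ j → I (suc n) (suc i) (suc j) * v (suc j))
      ≡⟨ cong₂ _+_ (trans (cong (_* v zero) (I-off (suc n) {suc i} {zero} λ ())) (*-zeroˡ (v zero)))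
                   (∑-cong (λ j → cong (_* v (suc j)) (I-reindex suc suc-injective i j))) ⟩
    + 0 + ∑ (λ j → I n i j * v (suc j))
      ≡⟨ +-identityˡ _ ⟩
    ∑ (λ j → I n i j * v (suc j))
      ≡⟨ ∑-I n i (λ j → v (suc j)) ⟩
    v (suc i) ∎

  infixr 20 _▷_
  _▷_ : ∀ {m n} → Matrix m n → Vector ℤ n → Vector ℤ m
  (A ▷ v) i = ∑ (λ k → A i k * v k)

  ⟨_,_⟩ : ∀ {n} → Vector ℤ n → Vector ℤ n → ℤ
  ⟨ v , w ⟩ = ∑ (λ k → v k * w k)

  -- v is an eigenvector of A for the eigenvalue θ (the zero vector included).
  Eigen : ∀ {n} → Matrix n n → ℤ → Vector ℤ n → Set
  Eigen A θ v = ∀ i → (A ▷ v) i ≡ θ * v i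

  ▷-cong : ∀ {m n} {A B : Matrix m n} → A ≐ B → ∀ v i → (A ▷ v) i ≡ (B ▷ v) i
  ▷-cong A≐B v i = ∑-cong (λ k → cong (_* v k) (A≐B i k))

  ▷-congʳ : ∀ {m n} (A : Matrix m n) {v w : Vector ℤ n} → (∀ k → v k ≡ w k) →
            ∀ i → (A ▷ v) i ≡ (A ▷ w) i
  ▷-congʳ A v≗w i = ∑-cong (λ k → cong (A i k *_) (v≗w k))

  ▷-zero : ∀ {m n} (A : Matrix m n) i → (A ▷ (λ _ → + 0)) i ≡ + 0
  ▷-zero {n = n} A i = trans (∑-cong (λ k → *-zeroʳ (A i k))) (∑-zero {n})

  ▷-scale : ∀ {m n} (A : Matrix m n) c v i → (A ▷ (λ k → c * v k)) i ≡ c * (A ▷ v) i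
  ▷-scale A c v i = trans (∑-cong (λ k → scalar-swap (A i k) c (v k))) (∑-*ˡ c (λ k → A i k * v k))
    where
    scalar-swap : ∀ a c x → a * (c * x) ≡ c * (a * x)
    scalar-swap = solve-∀

  ⊗-▷ : ∀ {m n p} (A : Matrix m n) (B : Matrix n p) v i → ((A ⊗ B) ▷ v) i ≡ (A ▷ (B ▷ v)) i
  ⊗-▷ A B v i = begin
    ∑ (λ k → ∑ (λ l → A i l * B l k) * v k)
      ≡⟨ ∑-cong (λ k → ∑-*ʳ (v k) (λ l → A i l * B l k)) ⟨
    ∑ (λ k → ∑ (λ l → A i l * B l k * v k))
      ≡⟨ ∑-swap (λ k l → A i l * B l k * v k) ⟩
    ∑ (λ l → ∑ (λ k → A i l * B l k * v k))
      ≡⟨ ∑-cong (λ l → trans (∑-cong (λ k → *-assoc (A i l) (B l k) (v k)))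
                             (∑-*ˡ (A i l) (λ k → B l k * v k))) ⟩
    ∑ (λ l → A i l * ∑ (λ k → B l k * v k)) ∎

  ▷-adjoint : ∀ {m n} (A : Matrix m n) v w → ⟨ A ▷ v , w ⟩ ≡ ⟨ v , (A ᵀ) ▷ w ⟩
  ▷-adjoint A v w = begin
    ∑ (λ i → ∑ (λ k → A i k * v k) * w i)
      ≡⟨ ∑-cong (λ i → ∑-*ʳ (w i) (λ k → A i k * v k)) ⟨
    ∑ (λ i → ∑ (λ k → A i k * v k * w i))
      ≡⟨ ∑-swap (λ i k → A i k * v k * w i) ⟩
    ∑ (λ k → ∑ (λ i → A i k * v k * w i))
      ≡⟨ ∑-cong (λ k → trans (∑-cong (λ i → regroup (A i k) (v k) (w i)))
                             (∑-*ˡ (v k) (λ i → A i k * w i))) ⟩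
    ∑ (λ k → v k * ∑ (λ i → A i k * w i)) ∎
    where
    regroup : ∀ a x y → a * x * y ≡ x * (a * y)
    regroup = solve-∀

  ▷-norm : ∀ {m n} (A : Matrix m n) v → ⟨ A ▷ v , A ▷ v ⟩ ≡ ⟨ v , ((A ᵀ) ⊗ A) ▷ v ⟩
  ▷-norm A v = trans (▷-adjoint A v (A ▷ v)) (∑-cong (λ k → cong (v k *_) (sym (⊗-▷ (A ᵀ) A v k))))

  -- If A Aᵀ = Aᵀ A = G, then A preserves every eigenspace of G: G A v = A Aᵀ A v = A G v.
  gram-eigen : ∀ {n} (A G : Matrix n n) → (A ⊗ (A ᵀ)) ≐ G → ((A ᵀ) ⊗ A) ≐ G →
               ∀ {θ v} → Eigen G θ v → Eigen G θ (A ▷ v)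
  gram-eigen A G AAᵀ≐G AᵀA≐G {θ} {v} Gv≡θv i = begin
    (G ▷ (A ▷ v)) i                ≡⟨ ▷-cong AAᵀ≐G (A ▷ v) i ⟨
    ((A ⊗ (A ᵀ)) ▷ (A ▷ v)) i      ≡⟨ ⊗-▷ A (A ᵀ) (A ▷ v) i ⟩
    (A ▷ ((A ᵀ) ▷ (A ▷ v))) i      ≡⟨ ▷-congʳ A AᵀAv≡θv i ⟩
    (A ▷ (λ k → θ * v k)) i        ≡⟨ ▷-scale A θ v i ⟩
    θ * (A ▷ v) i                  ∎
    where
    AᵀAv≡θv : ∀ k → ((A ᵀ) ▷ (A ▷ v)) k ≡ θ * v k
    AᵀAv≡θv k = trans (sym (⊗-▷ (A ᵀ) A v k)) (trans (▷-cong AᵀA≐G v k) (Gv≡θv k))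

  halves-≗ : ∀ {m n} {v w : Vector ℤ (m ℕ.+ n)} →
             (∀ a → v (a ↑ˡ n) ≡ w (a ↑ˡ n)) → (∀ b → v (m ↑ʳ b) ≡ w (m ↑ʳ b)) →
             ∀ i → v i ≡ w i
  halves-≗ {m} {v = v} {w} left right i with splitAt m i in split≡
  ... | inj₁ a = subst (λ k → v k ≡ w k) (splitAt⁻¹-↑ˡ split≡) (left a)
  ... | inj₂ b = subst (λ k → v k ≡ w k) (splitAt⁻¹-↑ʳ split≡) (right b)

  ⟨⟩-const-halves : ∀ {m n} {v w : Vector ℤ (m ℕ.+ n)} {p q r s} →
                    (∀ a → v (a ↑ˡ n) ≡ p) → (∀ a → w (a ↑ˡ n) ≡ q) →
                    (∀ b → v (m ↑ʳ b) ≡ r) → (∀ b → w (m ↑ʳ b) ≡ s) →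
                    ⟨ v , w ⟩ ≡ + m * (p * q) + + n * (r * s)
  ⟨⟩-const-halves {m} {n} {p = p} {q} {r} {s} v≡p w≡q v≡r w≡s =
    trans (∑-split m n _) (cong₂ _+_
      (trans (∑-cong (λ a → cong₂ _*_ (v≡p a) (w≡q a))) (∑-const {m} (p * q)))
      (trans (∑-cong (λ b → cong₂ _*_ (v≡r b) (w≡s b))) (∑-const {n} (r * s))))

  ▷-++ : ∀ {p m n} (M : Matrix p (m ℕ.+ n)) x y i →
         (M ▷ (x ++ y)) i ≡ ∑ (λ a → M i (a ↑ˡ n) * x a) + ∑ (λ b → M i (m ↑ʳ b) * y b)
  ▷-++ {m = m} {n} M x y i = trans (∑-split m n _) (cong₂ _+_
    (∑-cong (λ a → cong (M i (a ↑ˡ n) *_) (lookup-++ˡ x y a)))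
    (∑-cong (λ b → cong (M i (m ↑ʳ b) *_) (lookup-++ʳ x y b))))

  module _ {m n} (A : Matrix m m) (B : Matrix m n) (C : Matrix n m) (D : Matrix n n) where

    block-↑ˡ↑ˡ : ∀ a b → block A B C D (a ↑ˡ n) (b ↑ˡ n) ≡ A a b
    block-↑ˡ↑ˡ a b rewrite splitAt-↑ˡ m a n | splitAt-↑ˡ m b n = refl

    block-↑ˡ↑ʳ : ∀ a b → block A B C D (a ↑ˡ n) (m ↑ʳ b) ≡ B a b
    block-↑ˡ↑ʳ a b rewrite splitAt-↑ˡ m a n | splitAt-↑ʳ m n b = refl

    block-↑ʳ↑ˡ : ∀ a b → block A B C D (m ↑ʳ a) (b ↑ˡ n) ≡ C a b
    block-↑ʳ↑ˡ a b rewrite splitAt-↑ʳ m n a | splitAt-↑ˡ m b n = refl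

    block-↑ʳ↑ʳ : ∀ a b → block A B C D (m ↑ʳ a) (m ↑ʳ b) ≡ D a b
    block-↑ʳ↑ʳ a b rewrite splitAt-↑ʳ m n a | splitAt-↑ʳ m n b = refl

  module _ {m n} (A : Matrix m m) (D : Matrix n n) (w : Vector ℤ (m ℕ.+ n)) where

    diag-▷ˡ : ∀ a → (block A (O m n) (O n m) D ▷ w) (a ↑ˡ n) ≡ (A ▷ (λ b → w (b ↑ˡ n))) a
    diag-▷ˡ a = begin
      ∑ (λ k → block A (O m n) (O n m) D (a ↑ˡ n) k * w k)
        ≡⟨ trans (∑-split m n _) (cong₂ _+_
             (∑-cong (λ c → cong (_* w (c ↑ˡ n)) (block-↑ˡ↑ˡ A (O m n) (O n m) D a c)))
             (trans (∑-cong (λ b → trans (cong (_* w (m ↑ʳ b)) (block-↑ˡ↑ʳ A (O m n) (O n m) D a b))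
                                         (*-zeroˡ (w (m ↑ʳ b)))))
                    (∑-zero {n}))) ⟩
      (A ▷ (λ c → w (c ↑ˡ n))) a + + 0
        ≡⟨ +-identityʳ _ ⟩
      (A ▷ (λ c → w (c ↑ˡ n))) a ∎

    diag-▷ʳ : ∀ b → (block A (O m n) (O n m) D ▷ w) (m ↑ʳ b) ≡ (D ▷ (λ c → w (m ↑ʳ c))) b
    diag-▷ʳ b = begin
      ∑ (λ k → block A (O m n) (O n m) D (m ↑ʳ b) k * w k)
        ≡⟨ trans (∑-split m n _) (cong₂ _+_
             (trans (∑-cong (λ a → trans (cong (_* w (a ↑ˡ n)) (block-↑ʳ↑ˡ A (O m n) (O n m) D b a))
                                         (*-zeroˡ (w (a ↑ˡ n)))))
                    (∑-zero {m}))
             (∑-cong (λ c → cong (_* w (m ↑ʳ c)) (block-↑ʳ↑ʳ A (O m n) (O n m) D b c)))) ⟩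
      + 0 + (D ▷ (λ c → w (m ↑ʳ c))) b
        ≡⟨ +-identityˡ _ ⟩
      (D ▷ (λ c → w (m ↑ʳ c))) b ∎

  cI+dJ : ∀ m → ℤ → ℤ → Matrix m m
  cI+dJ m c d = (c · I m) ⊕ (d · J m m)

  cI+dJ-▷ : ∀ m c d (x : Vector ℤ m) a → (cI+dJ m c d ▷ x) a ≡ c * x a + d * ∑ x
  cI+dJ-▷ m c d x a = begin
    ∑ (λ b → (c * I m a b + d * + 1) * x b)
      ≡⟨ ∑-cong (λ b → expand c (I m a b) d (x b)) ⟩
    ∑ (λ b → c * (I m a b * x b) + d * x b)
      ≡⟨ ∑-+ (λ b → c * (I m a b * x b)) (λ b → d * x b) ⟩
    ∑ (λ b → c * (I m a b * x b)) + ∑ (λ b → d * x b)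
      ≡⟨ cong₂ _+_ (trans (∑-*ˡ c (λ b → I m a b * x b)) (cong (c *_) (∑-I m a x))) (∑-*ˡ d x) ⟩
    c * x a + d * ∑ x ∎
    where
    expand : ∀ c i d x → (c * i + d * + 1) * x ≡ c * (i * x) + d * x
    expand = solve-∀

  collect : ∀ c d m k → c * k + d * (m * k) ≡ (c + d * m) * k
  collect = solve-∀

  cI+dJ-const : ∀ m c d k → Eigen (cI+dJ m c d) (c + d * + m) (λ _ → k)
  cI+dJ-const m c d k a = begin
    (cI+dJ m c d ▷ (λ _ → k)) a ≡⟨ cI+dJ-▷ m c d (λ _ → k) a ⟩
    c * k + d * ∑ {m} (λ _ → k) ≡⟨ cong (λ σ → c * k + d * σ) (∑-const {m} k) ⟩
    c * k + d * (+ m * k)       ≡⟨ collect c d (+ m) k ⟩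
    (c + d * + m) * k           ∎

  Flat : ∀ {m} → Vector ℤ m → Set
  Flat {m} x = ∀ a → + m * x a ≡ ∑ x

  flat-≗ : ∀ {m} {x y : Vector ℤ m} → (∀ a → x a ≡ y a) → Flat x → Flat y
  flat-≗ {m} x≗y flat-x a = trans (cong (+ m *_) (sym (x≗y a))) (trans (flat-x a) (∑-cong x≗y))

  -- A flat vector with sum m k has all entries equal to k (m ≠ 0 as Fin m is inhabited).
  flat-value : ∀ {m} {x : Vector ℤ m} → Flat x → ∀ {k} → ∑ x ≡ + m * k → ∀ a → x a ≡ k
  flat-value {m} flat-x ∑x≡mk a =
    *-cancelˡ-≡ (+ m) _ _ {{nonZeroIndex a}} (trans (flat-x a) ∑x≡mk)

  -- For d ≠ 0 every eigenvector of c I + d J for c + d m is flat: c x + d (∑ x) 𝟏 = (c + d m) x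
  -- forces d (∑ x) = d m x.
  cI+dJ-flat : ∀ m c d .{{_ : NonZero d}} {x} → Eigen (cI+dJ m c d) (c + d * + m) x → Flat x
  cI+dJ-flat m c d {x} eigen a = *-cancelˡ-≡ d _ _ (∙-cancelˡ (c * x a) _ _ (begin
    c * x a + d * (+ m * x a) ≡⟨ collect c d (+ m) (x a) ⟩
    (c + d * + m) * x a       ≡⟨ eigen a ⟨
    (cI+dJ m c d ▷ x) a       ≡⟨ cI+dJ-▷ m c d x a ⟩
    c * x a + d * ∑ x         ∎))

  -- The eigenvalue (2m - 2) + 2m of EWGram m on vectors constant on each half.
  ewEigenvalue : ℕ → ℤ
  ewEigenvalue m = (+ (m ℕ.+ m) - + 2) + + 2 * + m

  ewEigenvalue-odd : ∀ t → ewEigenvalue (2 ℕ.* t ℕ.+ 1) ≡ + 1 + + (8 ℕ.* t ℕ.+ 1)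
  ewEigenvalue-odd t = begin
    (+ (m ℕ.+ m) - + 2) + + 2 * + m
      ≡⟨ cong (λ k → (k - + 2) + + 2 * + m) (pos-+ m m) ⟩
    (+ m + + m - + 2) + + 2 * + m
      ≡⟨ cong (λ k → (k + k - + 2) + + 2 * k) (pos-affine 2) ⟩
    ((+ 2 * + t + + 1) + (+ 2 * + t + + 1) - + 2) + + 2 * (+ 2 * + t + + 1)
      ≡⟨ normalise (+ t) ⟩
    + 1 + (+ 8 * + t + + 1)
      ≡⟨ cong (_+_ (+ 1)) (pos-affine 8) ⟨
    + 1 + + (8 ℕ.* t ℕ.+ 1) ∎
    where
    m = 2 ℕ.* t ℕ.+ 1
    pos-affine : ∀ a → + (a ℕ.* t ℕ.+ 1) ≡ + a * + t + + 1
    pos-affine a = trans (pos-+ (a ℕ.* t) 1) (cong (_+ + 1) (pos-* a t))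
    normalise : ∀ T → ((+ 2 * T + + 1) + (+ 2 * T + + 1) - + 2) + + 2 * (+ 2 * T + + 1)
                      ≡ + 1 + (+ 8 * T + + 1)
    normalise = solve-∀

  module _ (m : ℕ) where

    private
      c : ℤ
      c = + (m ℕ.+ m) - + 2
      D : Matrix m m
      D = cI+dJ m c (+ 2)

    ew-const-halves : ∀ k l → Eigen (EWGram m) (ewEigenvalue m) (replicate m k ++ replicate m l)
    ew-const-halves k l = halves-≗ {v = EWGram m ▷ u} {w = λ i → ewEigenvalue m * u i} top bottom
      where
      u : Vector ℤ (m ℕ.+ m)
      u = replicate m k ++ replicate m l
      top : ∀ a → (EWGram m ▷ u) (a ↑ˡ m) ≡ ewEigenvalue m * u (a ↑ˡ m)
      top a = begin
        (EWGram m ▷ u) (a ↑ˡ m)        ≡⟨ diag-▷ˡ D D u a ⟩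
        (D ▷ (λ b → u (b ↑ˡ m))) a     ≡⟨ ▷-congʳ D (lookup-++ˡ (replicate m k) (replicate m l)) a ⟩
        (D ▷ (λ _ → k)) a              ≡⟨ cI+dJ-const m c (+ 2) k a ⟩
        ewEigenvalue m * k             ≡⟨ cong (ewEigenvalue m *_) (lookup-++ˡ (replicate m k) (replicate m l) a) ⟨
        ewEigenvalue m * u (a ↑ˡ m)    ∎
      bottom : ∀ b → (EWGram m ▷ u) (m ↑ʳ b) ≡ ewEigenvalue m * u (m ↑ʳ b)
      bottom b = begin
        (EWGram m ▷ u) (m ↑ʳ b)        ≡⟨ diag-▷ʳ D D u b ⟩
        (D ▷ (λ j → u (m ↑ʳ j))) b     ≡⟨ ▷-congʳ D (lookup-++ʳ (replicate m k) (replicate m l)) b ⟩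
        (D ▷ (λ _ → l)) b              ≡⟨ cI+dJ-const m c (+ 2) l b ⟩
        ewEigenvalue m * l             ≡⟨ cong (ewEigenvalue m *_) (lookup-++ʳ (replicate m k) (replicate m l) b) ⟨
        ewEigenvalue m * u (m ↑ʳ b)    ∎

    ew-flat-halves : ∀ {w} → Eigen (EWGram m) (ewEigenvalue m) w →
                     Flat (λ a → w (a ↑ˡ m)) × Flat (λ b → w (m ↑ʳ b))
    ew-flat-halves {w} eigen =
      cI+dJ-flat m c (+ 2) (λ a → trans (sym (diag-▷ˡ D D w a)) (eigen (a ↑ˡ m))) ,
      cI+dJ-flat m c (+ 2) (λ b → trans (sym (diag-▷ʳ D D w b)) (eigen (m ↑ʳ b)))

  rowSum : ∀ {m n} → Matrix m n → Vector ℤ m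
  rowSum X = X ▷ (λ _ → + 1)

  total : ∀ {m n} → Matrix m n → ℤ
  total X = ∑ (rowSum X)

  total-cong : ∀ {m n} {X Y : Matrix m n} → X ≐ Y → total X ≡ total Y
  total-cong X≐Y = ∑-cong (λ a → ▷-cong X≐Y (λ _ → + 1) a)

  total-ᵀ : ∀ {m n} (X : Matrix m n) → total (X ᵀ) ≡ total X
  total-ᵀ X = ∑-swap (λ a b → X b a * + 1)

  total-⊕ : ∀ {m n} (X Y : Matrix m n) → total (X ⊕ Y) ≡ total X + total Y
  total-⊕ X Y = trans (∑-cong rowSum-⊕) (∑-+ (rowSum X) (rowSum Y))
    where
    rowSum-⊕ : ∀ a → rowSum (X ⊕ Y) a ≡ rowSum X a + rowSum Y a
    rowSum-⊕ a = trans (∑-cong (λ b → *-distribʳ-+ (+ 1) (X a b) (Y a b)))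
                       (∑-+ (λ b → X a b * + 1) (λ b → Y a b * + 1))

  total-· : ∀ {m n} c (X : Matrix m n) → total (c · X) ≡ c * total X
  total-· c X = trans (∑-cong rowSum-·) (∑-*ˡ c (rowSum X))
    where
    rowSum-· : ∀ a → rowSum (c · X) a ≡ c * rowSum X a
    rowSum-· a = trans (∑-cong (λ b → *-assoc c (X a b) (+ 1))) (∑-*ˡ c (λ b → X a b * + 1))

  total-I : ∀ m → total (I m) ≡ + m
  total-I m = trans (∑-cong (λ a → ∑-I m a (λ _ → + 1))) (trans (∑-const {m} (+ 1)) (*-identityʳ (+ m)))

  -- A skew-symmetric matrix (X + Xᵀ = 2I) of order m has total m, as 2 total X = total (2I).
  skew-total : ∀ {m} (X : Matrix m m) → IsSkew X → total X ≡ + m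
  skew-total {m} X skew = *-cancelˡ-≡ (+ 2) _ _ (begin
    + 2 * total X              ≡⟨ double (total X) ⟩
    total X + total X          ≡⟨ cong (_+_ (total X)) (total-ᵀ X) ⟨
    total X + total (X ᵀ)      ≡⟨ total-⊕ X (X ᵀ) ⟨
    total (X ⊕ (X ᵀ))          ≡⟨ total-cong skew ⟩
    total ((+ 2) · I m)        ≡⟨ total-· (+ 2) (I m) ⟩
    + 2 * total (I m)          ≡⟨ cong (+ 2 *_) (total-I m) ⟩
    + 2 * + m                  ∎)
    where
    double : ∀ x → + 2 * x ≡ x + x
    double = solve-∀

  antisym-total : ∀ {m n} (Y : Matrix m n) (Z : Matrix n m) → (∀ a b → Y a b ≡ - Z b a) →
                  total Y ≡ - total Z
  antisym-total Y Z Y≡-Zᵀ = begin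
    total Y               ≡⟨ total-cong (λ a b → trans (Y≡-Zᵀ a b) (sym (-1*i≡-i (Z b a)))) ⟩
    total (-1ℤ · (Z ᵀ))   ≡⟨ total-· -1ℤ (Z ᵀ) ⟩
    -1ℤ * total (Z ᵀ)     ≡⟨ cong (-1ℤ *_) (total-ᵀ Z) ⟩
    -1ℤ * total Z         ≡⟨ -1*i≡-i (total Z) ⟩
    - total Z             ∎

  module SkewEWBlocks {m : ℕ} (S : Matrix (m ℕ.+ m) (m ℕ.+ m))
                      (SSᵀ : (S ⊗ (S ᵀ)) ≐ EWGram m) (SᵀS : ((S ᵀ) ⊗ S) ≐ EWGram m)
                      (skew : IsSkew S) where

    θ : ℤ
    θ = ewEigenvalue m

    A₁₁ A₁₂ A₂₁ A₂₂ : Matrix m m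
    A₁₁ = S₁₁ S
    A₁₂ = S₁₂ S
    A₂₁ = S₂₁ S
    A₂₂ = S₂₂ S

    ones zeros : Vector ℤ m
    ones  = replicate m (+ 1)
    zeros = replicate m (+ 0)

    u₁ u₂ : Vector ℤ (m ℕ.+ m)
    u₁ = ones ++ zeros
    u₂ = zeros ++ ones

    Su₁-top : ∀ a → (S ▷ u₁) (a ↑ˡ m) ≡ rowSum A₁₁ a
    Su₁-top a = trans (▷-++ S ones zeros (a ↑ˡ m))
                      (trans (cong (_+_ (rowSum A₁₁ a)) (▷-zero A₁₂ a)) (+-identityʳ _))

    Su₁-bottom : ∀ a → (S ▷ u₁) (m ↑ʳ a) ≡ rowSum A₂₁ a
    Su₁-bottom a = trans (▷-++ S ones zeros (m ↑ʳ a))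
                         (trans (cong (_+_ (rowSum A₂₁ a)) (▷-zero A₂₂ a)) (+-identityʳ _))

    Su₂-top : ∀ a → (S ▷ u₂) (a ↑ˡ m) ≡ rowSum A₁₂ a
    Su₂-top a = trans (▷-++ S zeros ones (a ↑ˡ m))
                      (trans (cong (_+ rowSum A₁₂ a) (▷-zero A₁₁ a)) (+-identityˡ _))

    Su₂-bottom : ∀ a → (S ▷ u₂) (m ↑ʳ a) ≡ rowSum A₂₂ a
    Su₂-bottom a = trans (▷-++ S zeros ones (m ↑ʳ a))
                         (trans (cong (_+ rowSum A₂₂ a) (▷-zero A₂₁ a)) (+-identityˡ _))

    -- S u₁ and S u₂ are θ-eigenvectors of EWGram m, so all four blocks have flat row sums.
    Su₁-flat : Flat (λ a → (S ▷ u₁) (a ↑ˡ m)) × Flat (λ b → (S ▷ u₁) (m ↑ʳ b))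
    Su₁-flat = ew-flat-halves m {S ▷ u₁}
      (gram-eigen S (EWGram m) SSᵀ SᵀS {θ} {u₁} (ew-const-halves m (+ 1) (+ 0)))

    Su₂-flat : Flat (λ a → (S ▷ u₂) (a ↑ˡ m)) × Flat (λ b → (S ▷ u₂) (m ↑ʳ b))
    Su₂-flat = ew-flat-halves m {S ▷ u₂}
      (gram-eigen S (EWGram m) SSᵀ SᵀS {θ} {u₂} (ew-const-halves m (+ 0) (+ 1)))

    flat₁₁ : Flat (rowSum A₁₁)
    flat₁₁ = flat-≗ Su₁-top (proj₁ Su₁-flat)

    flat₂₁ : Flat (rowSum A₂₁)
    flat₂₁ = flat-≗ Su₁-bottom (proj₂ Su₁-flat)

    flat₁₂ : Flat (rowSum A₁₂)
    flat₁₂ = flat-≗ Su₂-top (proj₁ Su₂-flat)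

    flat₂₂ : Flat (rowSum A₂₂)
    flat₂₂ = flat-≗ Su₂-bottom (proj₂ Su₂-flat)

    skew₁₁ : IsSkew A₁₁
    skew₁₁ a b = trans (skew (a ↑ˡ m) (b ↑ˡ m))
                       (cong (+ 2 *_) (I-reindex (_↑ˡ m) (↑ˡ-injective m _ _) a b))

    skew₂₂ : IsSkew A₂₂
    skew₂₂ a b = trans (skew (m ↑ʳ a) (m ↑ʳ b))
                       (cong (+ 2 *_) (I-reindex (m ↑ʳ_) (↑ʳ-injective m _ _) a b))

    A₁₂≡-A₂₁ᵀ : ∀ a b → A₁₂ a b ≡ - A₂₁ b a
    A₁₂≡-A₂₁ᵀ a b = inverseˡ-unique _ _ (begin
      A₁₂ a b + A₂₁ b a             ≡⟨ skew (a ↑ˡ m) (m ↑ʳ b) ⟩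
      + 2 * I _ (a ↑ˡ m) (m ↑ʳ b)   ≡⟨ cong (+ 2 *_) (I-off _ (↑ˡ≢↑ʳ a b)) ⟩
      + 2 * + 0                     ∎)
      where
      ↑ˡ≢↑ʳ : ∀ a b → ¬ a ↑ˡ m ≡ m ↑ʳ b
      ↑ˡ≢↑ʳ a b a≡b with trans (sym (splitAt-↑ˡ m a m)) (trans (cong (splitAt m) a≡b) (splitAt-↑ʳ m m b))
      ... | ()

    A₂₁≡-A₁₂ᵀ : ∀ a b → A₂₁ a b ≡ - A₁₂ b a
    A₂₁≡-A₁₂ᵀ a b = trans (sym (neg-involutive _)) (cong -_ (sym (A₁₂≡-A₂₁ᵀ b a)))

    rowSum₁₁ : ∀ a → rowSum A₁₁ a ≡ + 1
    rowSum₁₁ = flat-value flat₁₁ (trans (skew-total A₁₁ skew₁₁) (sym (*-identityʳ (+ m))))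

    rowSum₂₂ : ∀ a → rowSum A₂₂ a ≡ + 1
    rowSum₂₂ = flat-value flat₂₂ (trans (skew-total A₂₂ skew₂₂) (sym (*-identityʳ (+ m))))

    rowSum₁₂ : ∀ a b → rowSum A₁₂ a ≡ rowSum A₁₂ b
    rowSum₁₂ a b = flat-value flat₁₂ (sym (flat₁₂ b)) a

    rowSum₂₁ : ∀ a b → rowSum A₂₁ a ≡ - rowSum A₁₂ b
    rowSum₂₁ a b = flat-value flat₂₁ (begin
      total A₂₁                    ≡⟨ antisym-total A₂₁ A₁₂ A₂₁≡-A₁₂ᵀ ⟩
      - total A₁₂                  ≡⟨ cong -_ (flat₁₂ b) ⟨
      - (+ m * rowSum A₁₂ b)       ≡⟨ neg-distribʳ-* (+ m) (rowSum A₁₂ b) ⟩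
      + m * - rowSum A₁₂ b         ∎) a

    -- Comparing ⟨S u₁, S u₁⟩ = m (1 + β²) with ⟨u₁, Sᵀ S u₁⟩ = m θ gives 1 + β² = θ.
    rowSum₁₂-square : ∀ b → let β = rowSum A₁₂ b in + 1 + β * β ≡ θ
    rowSum₁₂-square b = *-cancelˡ-≡ (+ m) _ _ {{nonZeroIndex b}} (begin
      + m * (+ 1 + β * β)                                  ≡⟨ split-norm (+ m) β ⟩
      + m * (+ 1 * + 1) + + m * (- β * - β)                ≡⟨ ⟨⟩-const-halves {v = S ▷ u₁} {w = S ▷ u₁} top top bottom bottom ⟨
      ⟨ S ▷ u₁ , S ▷ u₁ ⟩                                  ≡⟨ ▷-norm S u₁ ⟩
      ⟨ u₁ , ((S ᵀ) ⊗ S) ▷ u₁ ⟩                            ≡⟨ ∑-cong (λ k → cong (u₁ k *_) (Gu₁ k)) ⟩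
      ⟨ u₁ , (λ k → θ * u₁ k) ⟩                            ≡⟨ ⟨⟩-const-halves {v = u₁} {w = λ k → θ * u₁ k} u₁-top θu₁-top u₁-bottom θu₁-bottom ⟩
      + m * (+ 1 * (θ * + 1)) + + m * (+ 0 * (θ * + 0))    ≡⟨ eigen-norm (+ m) θ ⟩
      + m * θ                                              ∎)
      where
      β = rowSum A₁₂ b
      top : ∀ a → (S ▷ u₁) (a ↑ˡ m) ≡ + 1
      top a = trans (Su₁-top a) (rowSum₁₁ a)
      bottom : ∀ a → (S ▷ u₁) (m ↑ʳ a) ≡ - β
      bottom a = trans (Su₁-bottom a) (rowSum₂₁ a b)
      Gu₁ : ∀ k → (((S ᵀ) ⊗ S) ▷ u₁) k ≡ θ * u₁ k
      Gu₁ k = trans (▷-cong SᵀS u₁ k) (ew-const-halves m (+ 1) (+ 0) k)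
      u₁-top : ∀ a → u₁ (a ↑ˡ m) ≡ + 1
      u₁-top = lookup-++ˡ ones zeros
      u₁-bottom : ∀ a → u₁ (m ↑ʳ a) ≡ + 0
      u₁-bottom = lookup-++ʳ ones zeros
      θu₁-top : ∀ a → θ * u₁ (a ↑ˡ m) ≡ θ * + 1
      θu₁-top a = cong (θ *_) (u₁-top a)
      θu₁-bottom : ∀ a → θ * u₁ (m ↑ʳ a) ≡ θ * + 0
      θu₁-bottom a = cong (θ *_) (u₁-bottom a)
      split-norm : ∀ M x → M * (+ 1 + x * x) ≡ M * (+ 1 * + 1) + M * (- x * - x)
      split-norm = solve-∀
      eigen-norm : ∀ M t → M * (+ 1 * (t * + 1)) + M * (+ 0 * (t * + 0)) ≡ M * t
      eigen-norm = solve-∀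

  record SignedRoot (n : ℕ) (β : ℤ) : Set where
    field
      sign      : ℤ
      isUnit    : (sign ≡ + 1) ⊎ (sign ≡ - (+ 1))
      root      : ℕ
      root²     : root ℕ.* root ≡ n
      sign·root : sign * + root ≡ β

  unit·abs : ∀ β → Σ ℤ (λ ε → ((ε ≡ + 1) ⊎ (ε ≡ - (+ 1))) × (ε * + ∣ β ∣ ≡ β))
  unit·abs (+ k)    = + 1 , inj₁ refl , *-identityˡ (+ k)
  unit·abs -[1+ k ] = - (+ 1) , inj₂ refl , -1*i≡-i +[1+ k ]

  signed-root : ∀ β {n} → β * β ≡ + n → SignedRoot n β
  signed-root β β²≡n with unit·abs β
  ... | ε , ε-unit , ε|β|≡β = record
    { sign = ε ; isUnit = ε-unit ; root = ∣ β ∣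
    ; root² = trans (sym (abs-* β β)) (cong ∣_∣ β²≡n) ; sign·root = ε|β|≡β }

  -- Lemma 4.1 for every nonempty half-order m: if the eigenvalue (2m - 2) + 2m equals 1 + n,
  -- the diagonal blocks have row sums 1 and the off-diagonal ones row sums ε√n and -ε√n
  -- for a sign ε; a row index a₀ : Fin m witnesses m > 0.
  skewEW-rowSums : ∀ {m n} (S : Matrix (m ℕ.+ m) (m ℕ.+ m)) →
    (S ⊗ (S ᵀ)) ≐ EWGram m → ((S ᵀ) ⊗ S) ≐ EWGram m → IsSkew S →
    Fin m → ewEigenvalue m ≡ + 1 + + n →
    ((S₁₁ S ⊗ J m m) ≐ J m m)
    × ((S₂₂ S ⊗ J m m) ≐ J m m)
    × Σ ℤ (λ ε → ((ε ≡ + 1) ⊎ (ε ≡ - (+ 1)))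
        × Σ ℕ (λ s → (s ℕ.* s ≡ n)
          × ((S₁₂ S ⊗ J m m) ≐ ((ε * + s) · J m m))
          × ((S₂₁ S ⊗ J m m) ≐ ((- (ε * + s)) · J m m))))
  skewEW-rowSums {m} S SSᵀ SᵀS skew a₀ θ≡1+n =
    (λ a _ → rowSum₁₁ a) , (λ a _ → rowSum₂₂ a) ,
    sign , isUnit , root , root² ,
    (λ a _ → trans (rowSum₁₂ a a₀) (trans (sym sign·root) (sym (*-identityʳ _)))) ,
    (λ a _ → trans (rowSum₂₁ a a₀) (trans (cong -_ (sym sign·root)) (sym (*-identityʳ _))))
    where
    open SkewEWBlocks {m} S SSᵀ SᵀS skew
    β : ℤ
    β = rowSum A₁₂ a₀
    open SignedRoot (signed-root β (∙-cancelˡ (+ 1) _ _ (trans (rowSum₁₂-square a₀) θ≡1+n)))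

open RowSumsOfSkewEW using (skewEW-rowSums; ewEigenvalue-odd)

open import Defs
open import Data.Nat using (ℕ; _≤_; _+_; _*_)
open import Data.Integer using (ℤ; +_; -_)
import Data.Integer
open import Data.Product using (_×_; Σ; _,_)
open import Data.Sum using (_⊎_)
open import Relation.Binary.PropositionalEquality using (_≡_)
open import Data.Fin using (zero; _↑ʳ_)

-- Lemma 4.1. The ±1 entries and t ≥ 1 are not needed: the row index 2t ↑ʳ 0 shows
-- 2t + 1 > 0, and the eigenvalue of EWGram (2t + 1) is 1 + (8t + 1).

lemma4p1 : (t : ℕ) → 1 ≤ t →
    (S : Matrix ((2 * t + 1) + (2 * t + 1)) ((2 * t + 1) + (2 * t + 1))) →
    IsEW (2 * t + 1) S → IsSkew S →
    ((S₁₁ S ⊗ J (2 * t + 1) (2 * t + 1)) ≐ J (2 * t + 1) (2 * t + 1))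
    × ((S₂₂ S ⊗ J (2 * t + 1) (2 * t + 1)) ≐ J (2 * t + 1) (2 * t + 1))
    × Σ ℤ (λ ε → ((ε ≡ + 1) ⊎ (ε ≡ - (+ 1)))
        × Σ ℕ (λ s → (s * s ≡ 8 * t + 1)
          × ((S₁₂ S ⊗ J (2 * t + 1) (2 * t + 1)) ≐ ((ε Data.Integer.* + s) · J (2 * t + 1) (2 * t + 1)))
          × ((S₂₁ S ⊗ J (2 * t + 1) (2 * t + 1)) ≐ ((- (ε Data.Integer.* + s)) · J (2 * t + 1) (2 * t + 1)))))
lemma4p1 t _ S (_ , SSᵀ , SᵀS) skew =
  skewEW-rowSums S SSᵀ SᵀS skew (2 * t ↑ʳ zero) (ewEigenvalue-odd t)
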